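{- Let $G$ be a connected graph with no subgraph isomorphic to $Y$, and let $P=v_0v_1\dots v_\ell$ be a longest path in $G$ with $\ell\ge5$. For $0\le i\le\ell$ let $L_i=N_G(v_i)\setminus V(P)$. If $L_i\cap L_j\neq\emptyset$ where $i<j$, then $j=i+2$, or $i=1$ and $j=\ell-1$.
   Context: All graphs are finite and simple. $Y$ is the 7-vertex tree obtained from $K_{1,3}$ by subdividing each edge exactly once. -}

module Defs where

open import Data.Nat using (ℕ; zero; suc; _≤_)
open import Data.Fin using (Fin; zero; suc; inject₁; #_)
open import Data.Product using (Σ; _×_; ∃)
open import Relation.Binary.PropositionalEquality using (_≡_; _≢_)
open import Relation.Nullary using (¬_)
open import Function.Definitions using (Injective)

record Graph (n : ℕ) : Set₁ where
  field
    Adj    : Fin n → Fin n → Set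
    sym    : ∀ {u v} → Adj u v → Adj v u
    irrefl : ∀ {u} → ¬ Adj u u
open Graph public

data Walk {n : ℕ} (G : Graph n) : Fin n → Fin n → Set where
  here : ∀ {u} → Walk G u u
  step : ∀ {u w v} → Adj G u w → Walk G w v → Walk G u v

Connected : ∀ {n} → Graph n → Set
Connected G = ∀ u v → Walk G u v

record Path {n : ℕ} (G : Graph n) (ℓ : ℕ) : Set where
  field
    vtx      : Fin (suc ℓ) → Fin n
    distinct : Injective _≡_ _≡_ vtx
    adjacent : ∀ (i : Fin ℓ) → Adj G (vtx (inject₁ i)) (vtx (suc i))
open Path public

Longest : ∀ {n} {G : Graph n} {ℓ} → Path G ℓ → Set
Longest {G = G} {ℓ} P = ∀ m → Path G m → m ≤ ℓ

-- The tree Y: K_{1,3} with each edge subdivided once.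
-- Vertices: 0 = centre; 1,2,3 = subdivision vertices; 4,5,6 = leaves.
data YEdge : Fin 7 → Fin 7 → Set where
  e01 : YEdge (# 0) (# 1)
  e02 : YEdge (# 0) (# 2)
  e03 : YEdge (# 0) (# 3)
  e14 : YEdge (# 1) (# 4)
  e25 : YEdge (# 2) (# 5)
  e36 : YEdge (# 3) (# 6)

HasYSubgraph : ∀ {n} → Graph n → Set
HasYSubgraph {n} G =
  Σ (Fin 7 → Fin n) λ f → Injective _≡_ _≡_ f × (∀ {a b} → YEdge a b → Adj G (f a) (f b))

InL : ∀ {n} {G : Graph n} {ℓ} → Path G ℓ → Fin (suc ℓ) → Fin n → Set
InL {G = G} P i x = Adj G (vtx P i) x × (∀ k → vtx P k ≢ x)

-- A vertex x off a longest path P is adjacent to v_i and v_j (i < j).  If the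
-- positions i, j border a gap of P (i = 0, j = ℓ, or j = i + 1), x can be inserted
-- there and P was not longest.  Otherwise j ≥ i + 3, and either v_i or v_j is the
-- middle of five consecutive path vertices not containing the other one: those five
-- vertices, x and the other neighbour span a Y.  This fails only for i = 1, j = ℓ - 1.
module Submission where

open import Defs hiding (sym)
open import Data.Nat as ℕ using (ℕ; zero; suc; _≤_; _+_; _∸_; z≤n; s≤s; _≟_; _≤?_)
open import Data.Nat.Properties
open import Data.Fin as Fin using (Fin; toℕ; _<_; inject₁; fromℕ<; punchOut)
open import Data.Fin.Patterns using (0F; 1F; 2F; 3F; 4F; 5F; 6F)
open import Data.Fin.Properties
  using (toℕ<n; toℕ-injective; toℕ-fromℕ<; toℕ-inject₁; toℕ≤pred[n]; punchIn-punchOut; punchOut-injective)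
open import Data.Vec.Functional using (Vector; insertAt; tail)
open import Data.Vec.Functional.Properties using (insertAt-lookup; insertAt-punchIn)
open import Data.Product using (_×_; ∃; _,_)
open import Data.Sum using (_⊎_; inj₁; inj₂)
open import Data.Empty using (⊥-elim)
open import Function using (_∘_)
open import Function.Definitions using (Injective)
open import Relation.Binary using (Rel)
open import Relation.Binary.PropositionalEquality
  using (_≡_; _≢_; refl; sym; trans; cong; subst; subst₂; module ≡-Reasoning)
open import Relation.Nullary using (¬_; yes; no)

module _ {a} {A : Set a} where

  insertAt-punchOut : ∀ {m} (v : Vector A m) {p k : Fin (suc m)} (x : A) (p≢k : p ≢ k) →
                      insertAt v p x k ≡ v (punchOut p≢k)
  insertAt-punchOut v {p} x p≢k =
    trans (cong (insertAt v p x) (sym (punchIn-punchOut p≢k))) (insertAt-punchIn v p x _)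

  insertAt-injective : ∀ {m} {v : Vector A m} {x : A} → Injective _≡_ _≡_ v →
                       (∀ j → v j ≢ x) → ∀ p → Injective _≡_ _≡_ (insertAt v p x)
  insertAt-injective {v = v} {x} v-inj x∉v p {k₁} {k₂} e with p Fin.≟ k₁ | p Fin.≟ k₂
  ... | yes refl | yes refl = refl
  ... | yes refl | no p≢k₂  =
    ⊥-elim (x∉v _ (sym (trans (sym (insertAt-lookup v p x)) (trans e (insertAt-punchOut v x p≢k₂)))))
  ... | no p≢k₁  | yes refl =
    ⊥-elim (x∉v _ (sym (trans (sym (insertAt-lookup v p x)) (trans (sym e) (insertAt-punchOut v x p≢k₁)))))
  ... | no p≢k₁  | no p≢k₂  = punchOut-injective p≢k₁ p≢k₂
    (v-inj (trans (sym (insertAt-punchOut v x p≢k₁)) (trans e (insertAt-punchOut v x p≢k₂))))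

  insertAt-consecutive : ∀ {r ℓ} (R : Rel A r) (v : Vector A (suc ℓ)) (x : A) (p : Fin (suc (suc ℓ))) →
    (∀ i → R (v (inject₁ i)) (v (Fin.suc i))) →
    (∀ j → suc (toℕ j) ≡ toℕ p → R (v j) x) →
    (∀ j → toℕ j ≡ toℕ p → R x (v j)) →
    ∀ i → R (insertAt v p x (inject₁ i)) (insertAt v p x (Fin.suc i))
  insertAt-consecutive R v x Fin.zero _ _ after Fin.zero = after Fin.zero refl
  insertAt-consecutive R v x Fin.zero chain _ _ (Fin.suc i) = chain i
  insertAt-consecutive R v x (Fin.suc Fin.zero) _ before _ Fin.zero = before Fin.zero refl
  insertAt-consecutive {ℓ = suc ℓ} R v x (Fin.suc (Fin.suc p)) chain _ _ Fin.zero = chain Fin.zero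
  insertAt-consecutive {ℓ = suc ℓ} R v x (Fin.suc p) chain before after (Fin.suc i) =
    insertAt-consecutive R (tail v) x p (chain ∘ Fin.suc)
      (λ j e → before (Fin.suc j) (cong suc e)) (λ j e → after (Fin.suc j) (cong suc e)) i

record Window (ℓ c k : ℕ) : Set where
  field
    start   : ℕ
    centred : c ≡ 2 + start
    fits    : 4 + start ≤ ℓ
    avoids  : k ℕ.< start ⊎ 4 + start ℕ.< k

  excludes : ∀ t → t ≤ 4 → k ≢ start + t
  excludes t t≤4 k≡s+t with avoids
  ... | inj₁ k<s   = <⇒≱ k<s (subst (start ≤_) (sym k≡s+t) (m≤m+n start t))
  ... | inj₂ 4+s<k = <⇒≱ 4+s<k
    (subst (_≤ 4 + start) (sym k≡s+t) (≤-trans (+-monoʳ-≤ start t≤4) (≤-reflexive (+-comm start 4))))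

-- Gap p of a path of length ℓ lies between positions p − 1 and p (either may be missing).
data IndexCase (ℓ a b : ℕ) : Set where
  gap       : (p : ℕ) → p ≤ suc ℓ →
              (∀ k → k ≤ ℓ → suc k ≡ p ⊎ k ≡ p → k ≡ a ⊎ k ≡ b) → IndexCase ℓ a b
  windowAtA : Window ℓ a b → IndexCase ℓ a b
  windowAtB : Window ℓ b a → IndexCase ℓ a b
  permitted : b ≡ a + 2 ⊎ (a ≡ 1 × b ≡ ℓ ∸ 1) → IndexCase ℓ a b

far-apart-cases : ∀ {ℓ a b} → 3 + suc a ≤ b → b ℕ.< ℓ → IndexCase ℓ (suc a) b
far-apart-cases {ℓ} {zero} {suc (suc s)} (s≤s (s≤s 2≤s)) b<ℓ with 4 + s ≤? ℓ
... | yes fits = windowAtB (record { start = s ; centred = refl ; fits = fits ; avoids = inj₁ 2≤s })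
... | no ¬fits = permitted (inj₂ (refl , cong (_∸ 1) (sym (≤-antisym (≤-pred (≰⇒> ¬fits)) b<ℓ))))
far-apart-cases {ℓ} {suc c} {suc (suc s)} (s≤s (s≤s 3+c≤s)) b<ℓ = windowAtA (record
  { start   = c
  ; centred = refl
  ; fits    = ≤-trans (n≤1+n _) (≤-trans (s≤s (s≤s 3+c≤s)) (<⇒≤ b<ℓ))
  ; avoids  = inj₂ (s≤s (s≤s 3+c≤s))
  })

index-cases : ∀ {ℓ a b} → a ℕ.< b → b ≤ ℓ → IndexCase ℓ a b
index-cases {a = zero} _ _ = gap 0 z≤n λ { k _ (inj₁ ()) ; k _ (inj₂ refl) → inj₁ refl }
index-cases {ℓ} {suc a} {b} a<b b≤ℓ with b ≟ ℓ
... | yes refl = gap (suc b) ≤-refl λ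
  { k k≤b (inj₁ refl) → inj₂ refl
  ; k k≤b (inj₂ refl) → ⊥-elim (1+n≰n k≤b) }
... | no b≢ℓ with b ≟ 2 + a
... | yes refl = gap b (m≤n⇒m≤1+n b≤ℓ) λ
  { k _ (inj₁ refl) → inj₁ refl
  ; k _ (inj₂ refl) → inj₂ refl }
... | no b≢2+a with b ≟ 3 + a
... | yes refl = permitted (inj₁ (+-comm 2 (suc a)))
... | no b≢3+a =
  far-apart-cases (≤∧≢⇒< (≤∧≢⇒< a<b (b≢2+a ∘ sym)) (b≢3+a ∘ sym)) (≤∧≢⇒< b≤ℓ b≢ℓ)

-- Y is a path on five vertices with a pendant path of length 2 at its middle vertex.
data Spot : Set where
  onPath   : Fin 5 → Spot
  pendant₁ : Spot
  pendant₂ : Spot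

spot : Fin 7 → Spot
spot 0F = onPath 2F
spot 1F = onPath 1F
spot 2F = onPath 3F
spot 3F = pendant₁
spot 4F = onPath 0F
spot 5F = onPath 4F
spot 6F = pendant₂

unspot : Spot → Fin 7
unspot (onPath 0F) = 4F
unspot (onPath 1F) = 1F
unspot (onPath 2F) = 0F
unspot (onPath 3F) = 2F
unspot (onPath 4F) = 5F
unspot pendant₁    = 3F
unspot pendant₂    = 6F

unspot∘spot : ∀ a → unspot (spot a) ≡ a
unspot∘spot 0F = refl
unspot∘spot 1F = refl
unspot∘spot 2F = refl
unspot∘spot 3F = refl
unspot∘spot 4F = refl
unspot∘spot 5F = refl
unspot∘spot 6F = refl

spot-injective : Injective _≡_ _≡_ spot
spot-injective {a} {b} e = trans (sym (unspot∘spot a)) (trans (cong unspot e) (unspot∘spot b))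

module _ {n} (G : Graph n) where

  insertInGap : ∀ {ℓ} (P : Path G ℓ) {x} → (∀ k → vtx P k ≢ x) → (p : ℕ) → p ≤ suc ℓ →
                (∀ k → suc (toℕ k) ≡ p ⊎ toℕ k ≡ p → Adj G (vtx P k) x) → Path G (suc ℓ)
  insertInGap {ℓ} P {x} x∉P p p≤1+ℓ border = record
    { vtx      = insertAt (vtx P) slot x
    ; distinct = insertAt-injective (distinct P) x∉P slot
    ; adjacent = insertAt-consecutive (Adj G) (vtx P) x slot (adjacent P)
        (λ k e → border k (inj₁ (trans e toℕ-slot)))
        (λ k e → Graph.sym G (border k (inj₂ (trans e toℕ-slot))))
    }
    where
    slot : Fin (suc (suc ℓ))
    slot = fromℕ< (s≤s p≤1+ℓ)
    toℕ-slot : toℕ slot ≡ p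
    toℕ-slot = toℕ-fromℕ< (s≤s p≤1+ℓ)

  segmentIndex : ∀ {ℓ m} (s : ℕ) → s + m ≤ ℓ → Fin (suc m) → Fin (suc ℓ)
  segmentIndex s s+m≤ℓ i = fromℕ< (s≤s (≤-trans (+-monoʳ-≤ s (toℕ≤pred[n] i)) s+m≤ℓ))

  toℕ-segmentIndex : ∀ {ℓ m} (s : ℕ) (s+m≤ℓ : s + m ≤ ℓ) (i : Fin (suc m)) →
                     toℕ (segmentIndex s s+m≤ℓ i) ≡ s + toℕ i
  toℕ-segmentIndex s s+m≤ℓ i = toℕ-fromℕ< _

  ≡-segmentIndex : ∀ {ℓ m} (s : ℕ) (s+m≤ℓ : s + m ≤ ℓ) {k} (i : Fin (suc m)) →
                   toℕ k ≡ s + toℕ i → k ≡ segmentIndex s s+m≤ℓ i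
  ≡-segmentIndex s s+m≤ℓ i e = toℕ-injective (trans e (sym (toℕ-segmentIndex s s+m≤ℓ i)))

  segment : ∀ {ℓ m} (P : Path G ℓ) (s : ℕ) → s + m ≤ ℓ → Path G m
  segment {ℓ} {m} P s s+m≤ℓ = record
    { vtx      = vtx P ∘ index
    ; distinct = λ {i} {j} e → toℕ-injective (+-cancelˡ-≡ s _ _ (begin
        s + toℕ i          ≡⟨ toℕ-segmentIndex s s+m≤ℓ i ⟨
        toℕ (index i)      ≡⟨ cong toℕ (distinct P e) ⟩
        toℕ (index j)      ≡⟨ toℕ-segmentIndex s s+m≤ℓ j ⟩
        s + toℕ j          ∎))
    ; adjacent = λ i → subst₂ (λ u v → Adj G (vtx P u) (vtx P v))
        (≡-segmentIndex s s+m≤ℓ (inject₁ i)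
          (trans (toℕ-inject₁ _) (trans (toℕ-fromℕ< _) (cong (s +_) (sym (toℕ-inject₁ i))))))
        (≡-segmentIndex s s+m≤ℓ (Fin.suc i) (trans (cong suc (toℕ-fromℕ< _)) (sym (+-suc s (toℕ i)))))
        (adjacent P (edge i))
    }
    where
    open ≡-Reasoning
    index : Fin (suc m) → Fin (suc ℓ)
    index = segmentIndex s s+m≤ℓ
    edge : Fin m → Fin ℓ
    edge i = fromℕ< (subst (_≤ ℓ) (+-suc s (toℕ i)) (≤-trans (+-monoʳ-≤ s (toℕ<n i)) s+m≤ℓ))

  pendantPath⇒HasYSubgraph : (u : Path G 4) (x y : Fin n) →
    (∀ k → vtx u k ≢ x) → (∀ k → vtx u k ≢ y) → x ≢ y →
    Adj G (vtx u 2F) x → Adj G x y → HasYSubgraph G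
  pendantPath⇒HasYSubgraph u x y x∉u y∉u x≢y u₂~x x~y =
    place ∘ spot , spot-injective ∘ place-injective , edge
    where
    place : Spot → Fin n
    place (onPath k) = vtx u k
    place pendant₁   = x
    place pendant₂   = y

    place-injective : Injective _≡_ _≡_ place
    place-injective {onPath k} {onPath l} e = cong onPath (distinct u e)
    place-injective {onPath k} {pendant₁} e = ⊥-elim (x∉u k e)
    place-injective {onPath k} {pendant₂} e = ⊥-elim (y∉u k e)
    place-injective {pendant₁} {onPath l} e = ⊥-elim (x∉u l (sym e))
    place-injective {pendant₁} {pendant₁} e = refl
    place-injective {pendant₁} {pendant₂} e = ⊥-elim (x≢y e)
    place-injective {pendant₂} {onPath l} e = ⊥-elim (y∉u l (sym e))
    place-injective {pendant₂} {pendant₁} e = ⊥-elim (x≢y (sym e))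
    place-injective {pendant₂} {pendant₂} e = refl

    edge : ∀ {a b} → YEdge a b → Adj G (place (spot a)) (place (spot b))
    edge e01 = Graph.sym G (adjacent u 1F)
    edge e02 = adjacent u 2F
    edge e03 = u₂~x
    edge e14 = Graph.sym G (adjacent u 0F)
    edge e25 = adjacent u 3F
    edge e36 = x~y

  window⇒HasYSubgraph : ∀ {ℓ} (P : Path G ℓ) {x} → (∀ k → vtx P k ≢ x) → (c k : Fin (suc ℓ)) →
    Window ℓ (toℕ c) (toℕ k) → Adj G (vtx P c) x → Adj G (vtx P k) x → HasYSubgraph G
  window⇒HasYSubgraph {ℓ} P {x} x∉P c k w c~x k~x =
    pendantPath⇒HasYSubgraph (segment P start fits′) x (vtx P k)
      (x∉P ∘ segmentIndex start fits′)
      (λ i e → excludes (toℕ i) (toℕ≤pred[n] i)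
        (trans (cong toℕ (sym (distinct P e))) (toℕ-segmentIndex start fits′ i)))
      (λ e → x∉P k (sym e))
      (subst (λ v → Adj G v x)
        (cong (vtx P) (≡-segmentIndex start fits′ 2F (trans centred (+-comm 2 start)))) c~x)
      (Graph.sym G k~x)
    where
    open Window w
    fits′ : start + 4 ≤ ℓ
    fits′ = subst (_≤ ℓ) (+-comm 4 start) fits

lemma2p7 : ∀ {n} (G : Graph n) → Connected G → ¬ HasYSubgraph G →
    ∀ {ℓ} (P : Path G ℓ) → Longest P → 5 ≤ ℓ →
    ∀ (i j : Fin (suc ℓ)) → i < j →
    ∃ (λ x → InL P i x × InL P j x) →
    toℕ j ≡ toℕ i + 2 ⊎ (toℕ i ≡ 1 × toℕ j ≡ ℓ ∸ 1)
lemma2p7 G _ noY {ℓ} P longest _ i j i<j (x , (i~x , x∉P) , (j~x , _))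
  with index-cases i<j (toℕ≤pred[n] j)
... | gap p p≤1+ℓ border =
  ⊥-elim (1+n≰n (longest (suc ℓ) (insertInGap G P x∉P p p≤1+ℓ border′)))
  where
  border′ : ∀ k → suc (toℕ k) ≡ p ⊎ toℕ k ≡ p → Adj G (vtx P k) x
  border′ k side with border (toℕ k) (toℕ≤pred[n] k) side
  ... | inj₁ k≡i = subst (λ v → Adj G (vtx P v) x) (toℕ-injective (sym k≡i)) i~x
  ... | inj₂ k≡j = subst (λ v → Adj G (vtx P v) x) (toℕ-injective (sym k≡j)) j~x
... | windowAtA w = ⊥-elim (noY (window⇒HasYSubgraph G P x∉P i j w i~x j~x))
... | windowAtB w = ⊥-elim (noY (window⇒HasYSubgraph G P x∉P j i w j~x i~x))
... | permitted r = r
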